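{- Let $m\ge 3$ and $n\ge 3$ be integers, $\omega=e^{2\pi i/m}$, and let $A=(a_{pq})$ be an $n\times n$ matrix. Then $$\mathrm{per}_\omega A = a_{11}\,\mathrm{per}_\omega(\overline{A}_{11}) + \omega\sum_{j=2}^{n} a_{1j}\,\mathrm{per}_\omega(\overline{A}_{1j}),$$ where $\mathrm{per}_\omega$ on the right-hand side is taken for matrices of order $n-1$ (with the same $m$ and $\omega$).
   Context: $\mathcal{S}^{(N)}$ is the symmetric group on $\{1,\dots,N\}$. For $s\in\mathcal{S}^{(N)}$, $\gamma(s)$ is the number of cycles of $s$ including fixed points, and the decrement is $d(s)=N-\gamma(s)$. For $0\le k<m$, $\mathcal{S}^{(N)}_{k,m}=\{s\in\mathcal{S}^{(N)}: d(s)\equiv k \pmod m\}$. For a square matrix $B=(b_{pq})$ of order $N$, its $\omega$-permanent is $$\mathrm{per}_\omega B=\sum_{k=0}^{m-1}\omega^{k}\sum_{s\in\mathcal{S}^{(N)}_{k,m}}\prod_{p=1}^{N} b_{p,s(p)}.$$ For an $n\times n$ matrix $A$ with columns $c_1,\dots,c_n$: $\overline{A}_{11}$ is the submatrix obtained by deleting row $1$ and column $1$; for $2\le j\le n$, $\overline{A}_{1j}$ is the $(n-1)\times(n-1)$ matrix obtained by deleting row $1$ and column $j$ and arranging the remaining columns in the order $c_2,c_3,\dots,c_{j-1},c_1,c_{j+1},\dots,c_n$; explicitly its $(p,q)$ entry is $a_{p+1,\psi(q)}$ with $\psi(q)=q+1$ for $q\ne j-1$ and $\psi(j-1)=1$.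 -}

module Defs where

open import Level using (Level)
open import Algebra.Bundles using (CommutativeRing)
open import Data.Nat.Base using (ℕ; zero; suc; _∸_; _≤ᵇ_; ∣_-_∣)
open import Data.Nat.Divisibility using (_∣?_)
open import Data.Fin.Base as F using (Fin; toℕ)
open import Data.Fin.Properties using (_≟_)
open import Data.Bool.Base using (Bool; true; false; not; _∨_; _∧_; T)
open import Data.List.Base using (List; []; _∷_; map; concatMap; foldr; filter; length; allFin; upTo)
open import Data.Vec.Functional as VF using (Vector)
open import Relation.Nullary.Decidable using (⌊_⌋)
open import Relation.Nullary.Decidable using (T?)

all : {A : Set} → (A → Bool) → List A → Bool
all f xs = foldr (λ a acc → f a ∧ acc) true xs

maps : (k N : ℕ) → List (Fin k → Fin N)
maps zero    N = (λ ()) ∷ []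
maps (suc k) N = concatMap (λ f → map (λ i → i VF.∷ f) (allFin N)) (maps k N)

isInjᵇ : {N : ℕ} → (Fin N → Fin N) → Bool
isInjᵇ {N} f = all (λ p → all (λ q → not ⌊ f p ≟ f q ⌋ ∨ ⌊ p ≟ q ⌋) (allFin N)) (allFin N)

-- The symmetric group S^(N): all injective (hence bijective) self-maps of Fin N.
perms : (N : ℕ) → List (Fin N → Fin N)
perms N = filter (λ f → T? (isInjᵇ f)) (maps N N)

iter : {N : ℕ} → (Fin N → Fin N) → ℕ → Fin N → Fin N
iter s zero    p = p
iter s (suc k) p = s (iter s k p)

-- p is the least element of its cycle under s (orbit = {s^k p : k < N}).
isCycleMinᵇ : {N : ℕ} → (Fin N → Fin N) → Fin N → Bool
isCycleMinᵇ {N} s p = all (λ k → toℕ p ≤ᵇ toℕ (iter s k p)) (upTo N)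

-- γ(s): number of cycles (including fixed points) = number of cycle minima.
γ : {N : ℕ} → (Fin N → Fin N) → ℕ
γ {N} s = length (filter (λ p → T? (isCycleMinᵇ s p)) (allFin N))

dec : {N : ℕ} → (Fin N → Fin N) → ℕ
dec {N} s = N ∸ γ s

congrᵇ : ℕ → ℕ → ℕ → Bool
congrᵇ d k m = ⌊ m ∣? ∣ d - k ∣ ⌋

module Per {c ℓ : Level} (R : CommutativeRing c ℓ) where
  open CommutativeRing R

  pow : Carrier → ℕ → Carrier
  pow x zero    = 1#
  pow x (suc k) = x * pow x k

  sumL : {A : Set} → (A → Carrier) → List A → Carrier
  sumL f xs = foldr (λ a acc → f a + acc) 0# xs

  prodL : {A : Set} → (A → Carrier) → List A → Carrier
  prodL f xs = foldr (λ a acc → f a * acc) 1# xs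

  permsKM : (N k m : ℕ) → List (Fin N → Fin N)
  permsKM N k m = filter (λ s → T? (congrᵇ (dec s) k m)) (perms N)

  per : (m : ℕ) → Carrier → (N : ℕ) → (Fin N → Fin N → Carrier) → Carrier
  per m ω N B =
    sumL (λ k → pow ω k * sumL (λ s → prodL (λ p → B p (s p)) (allFin N)) (permsKM N k m)) (upTo m)

  minor11 : {N : ℕ} → (Fin (suc N) → Fin (suc N) → Carrier) → Fin N → Fin N → Carrier
  minor11 A p q = A (F.suc p) (F.suc q)

  -- \bar A_{1j} for j = t+2 (1-based), t : Fin N (0-based), matrix of order suc N:
  -- (p,q) entry is A (p+1) ψ(q), ψ(q) = q+1 if q ≠ t, ψ(t) = 0 (0-based indices).
  minor1 : {N : ℕ} → (Fin (suc N) → Fin (suc N) → Carrier) → Fin N → Fin N → Fin N → Carrier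
  minor1 A t p q with ⌊ q ≟ t ⌋
  ... | true  = A (F.suc p) F.zero
  ... | false = A (F.suc p) (F.suc q)

-- With ω ^ m = 1 the weight ω ^ k of the class d(s) ≡ k (mod m) is just ω ^ d(s), so per_ω B is
-- the sum of ω ^ d(s) ∏ B p (s p) over all permutations s. Expand along row 0 (all indices are
-- 0-based). A permutation with s 0 = 0 is a permutation f of the other points with the same cycles,
-- so d(s) = d(f). A permutation with s 0 = suc t arises from exactly one permutation f of the other
-- points by inserting 0 into the cycle of f through t, just before suc t. This keeps the number of
-- cycles and adds a point, so d(s) = d(f) + 1, which is the factor ω; and reading column 0 as
-- column suc t turns ∏ A p (s p) into A 0 (suc t) times the diagonal product of minor1 A t along f.
-- Cycles are counted by their least elements: after the insertion 0 is the least element of the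
-- enlarged cycle, and the old least element stops counting.
module Submission where

open import Defs
open import Algebra.Bundles using (CommutativeRing)
open import Data.Nat.Base using (ℕ; suc; _≤_; _<_)
open import Data.Fin.Base as F using (Fin)
open import Data.List.Base using (allFin)
open import Relation.Nullary using (¬_)

open import Data.Bool.Base using (Bool; true; false; not; _∨_; T; if_then_else_)
open import Data.Bool.Properties using (T-≡; T-∧; ⇔→≡; ¬-not)
open import Data.Fin.Base using (zero; suc; toℕ; fromℕ<; punchIn)
import Data.Fin.Permutation as Perm
import Data.Fin.Permutation.Components as PC
open import Data.Fin.Properties
  using (_≟_; pigeonhole; toℕ-injective; toℕ<n; toℕ-fromℕ<; suc-injective; punchInᵢ≢i)
open import Data.List.Base using (List; []; _∷_; _++_; map; concatMap; filter; length; tabulate; applyUpTo; upTo)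
import Data.List.Extrema
open import Data.List.Relation.Unary.All using (All; []; _∷_)
open import Data.List.Relation.Unary.All.Properties
  using (tabulate⁺; tabulate⁻; applyUpTo⁺₁; applyUpTo⁺₂; applyUpTo⁻)
open import Data.Nat.Base using (zero; _∸_; ∣_-_∣; NonZero; z≤n; s≤s)
import Data.Nat.Base as ℕ
open import Data.Nat.DivMod using (_%_; _/_; m≡m%n+[m/n]*n; m%n<n; m%n≤m; m<n⇒m%n≡m; %-remove-+ʳ)
open import Data.Nat.Divisibility using (_∣_; _∣?_; divides)
import Data.Nat.Properties as ℕₚ
open import Data.Product using (∃; _×_; _,_; proj₁; proj₂)
open import Data.Sum using (_⊎_; inj₁; inj₂)
open import Data.Unit using (tt)
import Data.Vec.Functional as VF
open import Data.Vec.Functional.Properties using (∷-cong)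
open import Function using (_∘_; id)
open import Function.Bundles using (_⇔_; mk⇔; Equivalence)
open import Function.Construct.Composition using (_⇔-∘_)
open import Function.Construct.Symmetry using (⇔-sym)
open import Function.Definitions using (Injective)
open import Relation.Binary.PropositionalEquality
  using (_≡_; _≢_; _≗_; refl; sym; trans; cong; cong₂; subst; module ≡-Reasoning)
open import Relation.Nullary.Decidable using (Dec; yes; no; ⌊_⌋; T?)
open import Relation.Nullary.Negation using (contradiction)

open Equivalence using (to; from)

-- Boolean reflection

T-⇔⇒≡ : ∀ {a b} {P Q : Set} → T a ⇔ P → T b ⇔ Q → P ⇔ Q → a ≡ b
T-⇔⇒≡ a⇔P b⇔Q P⇔Q = ⇔→≡ (T-≡ ⇔-∘ (⇔-sym b⇔Q ⇔-∘ (P⇔Q ⇔-∘ (a⇔P ⇔-∘ ⇔-sym T-≡))))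

T-all : ∀ {A : Set} (b : A → Bool) (xs : List A) → T (all b xs) ⇔ All (T ∘ b) xs
T-all b []       = mk⇔ (λ _ → []) (λ _ → tt)
T-all b (x ∷ xs) = mk⇔
  (λ h → let (bx , bxs) = to T-∧ h in bx ∷ to (T-all b xs) bxs)
  (λ { (bx ∷ bxs) → from T-∧ (bx , from (T-all b xs) bxs) })

T-all-allFin : ∀ {n} (b : Fin n → Bool) → T (all b (allFin n)) ⇔ (∀ i → T (b i))
T-all-allFin b = mk⇔ (tabulate⁻ ∘ to (T-all b _)) (from (T-all b _) ∘ tabulate⁺)

T-all-upTo : ∀ n (b : ℕ → Bool) → T (all b (upTo n)) ⇔ (∀ {k} → k < n → T (b k))
T-all-upTo n b = mk⇔ (applyUpTo⁻ id n ∘ to (T-all b _)) (from (T-all b _) ∘ applyUpTo⁺₁ id n)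

T-implies : ∀ {A B : Set} (a? : Dec A) (b? : Dec B) → T (not ⌊ a? ⌋ ∨ ⌊ b? ⌋) ⇔ (A → B)
T-implies (no ¬a) _       = mk⇔ (λ _ a → contradiction a ¬a) (λ _ → tt)
T-implies (yes _) (yes b) = mk⇔ (λ _ _ → b) (λ _ → tt)
T-implies (yes a) (no ¬b) = mk⇔ (λ ()) (λ a→b → ¬b (a→b a))

T-isInjᵇ : ∀ {n} (f : Fin n → Fin n) → T (isInjᵇ f) ⇔ Injective _≡_ _≡_ f
T-isInjᵇ f = mk⇔
  (λ h {p} {q} → to (T-implies (f p ≟ f q) (p ≟ q)) (to (T-all-allFin _) (to (T-all-allFin _) h p) q))
  (λ inj → from (T-all-allFin _) λ p → from (T-all-allFin _) λ q →
     from (T-implies (f p ≟ f q) (p ≟ q)) inj)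

isInjᵇ-cong : ∀ {n} {s s′ : Fin n → Fin n} → s ≗ s′ → isInjᵇ s ≡ isInjᵇ s′
isInjᵇ-cong {s = s} {s′} s≗s′ =
  T-⇔⇒≡ (T-isInjᵇ s) (T-isInjᵇ s′) (mk⇔ (transport s≗s′) (transport (sym ∘ s≗s′)))
  where
  transport : ∀ {f g : Fin _ → Fin _} → f ≗ g → Injective _≡_ _≡_ f → Injective _≡_ _≡_ g
  transport f≗g f-inj e = f-inj (trans (f≗g _) (trans e (sym (f≗g _))))

-- Orbits and cycle minima

iter-cong : ∀ {n} {s s′ : Fin n → Fin n} → s ≗ s′ → ∀ k p → iter s k p ≡ iter s′ k p
iter-cong e zero    p = refl
iter-cong {s = s} e (suc k) p = trans (cong s (iter-cong e k p)) (e _)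

module _ {n : ℕ} (s : Fin n → Fin n) where

  iter-+ : ∀ a b p → iter s (a ℕ.+ b) p ≡ iter s a (iter s b p)
  iter-+ zero    b p = refl
  iter-+ (suc a) b p = cong s (iter-+ a b p)

  iter-*-period : ∀ {c x} → iter s c x ≡ x → ∀ q → iter s (q ℕ.* c) x ≡ x
  iter-*-period e zero            = refl
  iter-*-period {c} {x} e (suc q) =
    trans (iter-+ c (q ℕ.* c) x) (trans (cong (iter s c) (iter-*-period e q)) e)

module _ {n : ℕ} {s : Fin n → Fin n} (s-inj : Injective _≡_ _≡_ s) where
  open ≡-Reasoning

  iter-injective : ∀ k → Injective _≡_ _≡_ (iter s k)
  iter-injective zero    e = e
  iter-injective (suc k) e = iter-injective k (s-inj e)

  period : ∀ x → ∃ λ c → 0 < c × c ≤ n × iter s c x ≡ x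
  period x with pigeonhole (ℕₚ.n<1+n n) (λ (i : Fin (suc n)) → iter s (toℕ i) x)
  ... | i , j , i<j , eq =
    c , ℕₚ.m<n⇒0<n∸m i<j , ℕₚ.≤-trans (ℕₚ.m∸n≤m (toℕ j) (toℕ i)) (ℕₚ.≤-pred (toℕ<n j)) ,
        sym (iter-injective (toℕ i) (begin
          iter s (toℕ i) x             ≡⟨ eq ⟩
          iter s (toℕ j) x             ≡⟨ cong (λ k → iter s k x) (ℕₚ.m+[n∸m]≡n (ℕₚ.<⇒≤ i<j)) ⟨
          iter s (toℕ i ℕ.+ c) x       ≡⟨ iter-+ s (toℕ i) c x ⟩
          iter s (toℕ i) (iter s c x)  ∎))
    where
    c : ℕ
    c = toℕ j ∸ toℕ i

  iter-below : ∀ k x → ∃ λ k′ → k′ < n × iter s k x ≡ iter s k′ x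
  iter-below k x with period x
  ... | c@(suc _) , _ , c≤n , e = k % c , ℕₚ.≤-trans (m%n<n k c) c≤n , (begin
        iter s k x                                 ≡⟨ cong (λ k → iter s k x) (m≡m%n+[m/n]*n k c) ⟩
        iter s (k % c ℕ.+ (k / c) ℕ.* c) x         ≡⟨ iter-+ s (k % c) _ x ⟩
        iter s (k % c) (iter s ((k / c) ℕ.* c) x)  ≡⟨ cong (iter s (k % c)) (iter-*-period s e (k / c)) ⟩
        iter s (k % c) x                           ∎)

  iter-positive : ∀ a {x y} → iter s a x ≡ y → ∃ λ k → iter s (suc k) x ≡ y
  iter-positive a {x} {y} e with period x
  ... | suc c , _ , _ , ec = a ℕ.+ c , (begin
        iter s (suc (a ℕ.+ c)) x     ≡⟨ cong (λ k → iter s k x) (ℕₚ.+-suc a c) ⟨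
        iter s (a ℕ.+ suc c) x       ≡⟨ iter-+ s a (suc c) x ⟩
        iter s a (iter s (suc c) x)  ≡⟨ cong (iter s a) ec ⟩
        iter s a x                   ≡⟨ e ⟩
        y                            ∎)

  iter-return : ∀ a {x y} → iter s a x ≡ y → ∃ λ b → iter s b y ≡ x
  iter-return a {x} {y} e with period x
  ... | c@(suc _) , _ , _ , ec = M ∸ a , (begin
        iter s (M ∸ a) y             ≡⟨ cong (iter s (M ∸ a)) e ⟨
        iter s (M ∸ a) (iter s a x)  ≡⟨ iter-+ s (M ∸ a) a x ⟨
        iter s (M ∸ a ℕ.+ a) x       ≡⟨ cong (λ k → iter s k x) (ℕₚ.m∸n+n≡m a≤M) ⟩
        iter s M x                   ≡⟨ iter-*-period s {c} {x} ec (suc a) ⟩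
        x                            ∎)
    where
    M : ℕ
    M = suc a ℕ.* c
    a≤M : a ≤ M
    a≤M = ℕₚ.≤-trans (ℕₚ.n≤1+n a) (ℕₚ.m≤m*n (suc a) c)

CycleMin : ∀ {n} → (Fin n → Fin n) → Fin n → Set
CycleMin s p = ∀ k → toℕ p ≤ toℕ (iter s k p)

T-isCycleMinᵇ : ∀ {n} (s : Fin n → Fin n) p →
  T (isCycleMinᵇ s p) ⇔ (∀ k → k < n → toℕ p ≤ toℕ (iter s k p))
T-isCycleMinᵇ {n} s p = mk⇔
  (λ h k k<n → ℕₚ.≤ᵇ⇒≤ _ _ (to (T-all-upTo n _) h k<n))
  (λ h → from (T-all-upTo n _) (λ {k} k<n → ℕₚ.≤⇒≤ᵇ (h k k<n)))

isCycleMinᵇ-cong : ∀ {n} {s s′ : Fin n → Fin n} → s ≗ s′ → ∀ p →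
  isCycleMinᵇ s p ≡ isCycleMinᵇ s′ p
isCycleMinᵇ-cong {n} {s} {s′} e p = T-⇔⇒≡ (T-isCycleMinᵇ s p) (T-isCycleMinᵇ s′ p) transport
  where
  transport : (∀ k → k < n → toℕ p ≤ toℕ (iter s k p)) ⇔
              (∀ k → k < n → toℕ p ≤ toℕ (iter s′ k p))
  transport = mk⇔
    (λ h k k<n → subst (λ q → toℕ p ≤ toℕ q) (iter-cong e k p) (h k k<n))
    (λ h k k<n → subst (λ q → toℕ p ≤ toℕ q) (sym (iter-cong e k p)) (h k k<n))

T-isCycleMinᵇ⇔CycleMin : ∀ {n} {s : Fin n → Fin n} → Injective _≡_ _≡_ s → ∀ p →
  T (isCycleMinᵇ s p) ⇔ CycleMin s p
T-isCycleMinᵇ⇔CycleMin {s = s} s-inj p =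
  mk⇔ bounded⇒all (λ h → from (T-isCycleMinᵇ s p) (λ k _ → h k))
  where
  bounded⇒all : T (isCycleMinᵇ s p) → CycleMin s p
  bounded⇒all h k with iter-below s-inj k p
  ... | k′ , k′<n , e = subst (λ q → toℕ p ≤ toℕ q) (sym e) (to (T-isCycleMinᵇ s p) h k′ k′<n)

countTrue : ∀ {n} → (Fin n → Bool) → ℕ
countTrue {zero}  b = 0
countTrue {suc n} b = if b zero then suc (countTrue (b ∘ suc)) else countTrue (b ∘ suc)

length-filter-tabulate : ∀ {A : Set} {n} (b : A → Bool) (g : Fin n → A) →
  length (filter (T? ∘ b) (tabulate g)) ≡ countTrue (b ∘ g)
length-filter-tabulate {n = zero}  b g = refl
length-filter-tabulate {n = suc n} b g with b (g zero)
... | true  = cong suc (length-filter-tabulate b (g ∘ suc))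
... | false = length-filter-tabulate b (g ∘ suc)

countTrue-cong : ∀ {n} {b b′ : Fin n → Bool} → b ≗ b′ → countTrue b ≡ countTrue b′
countTrue-cong {zero}  e = refl
countTrue-cong {suc n} {b} {b′} e
  rewrite e zero | countTrue-cong {b = b ∘ suc} {b′ ∘ suc} (e ∘ suc) = refl

countTrue≤n : ∀ {n} (b : Fin n → Bool) → countTrue b ≤ n
countTrue≤n {zero}  b = z≤n
countTrue≤n {suc n} b with b zero
... | true  = s≤s (countTrue≤n (b ∘ suc))
... | false = ℕₚ.m≤n⇒m≤1+n (countTrue≤n (b ∘ suc))

countTrue-zero : ∀ {n} (b : Fin (suc n) → Bool) → b zero ≡ true →
  countTrue b ≡ suc (countTrue (b ∘ suc))
countTrue-zero b e rewrite e = refl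

countTrue-remove : ∀ {n} {b b′ : Fin n → Bool} t → b t ≡ true → b′ t ≡ false →
  (∀ i → i ≢ t → b i ≡ b′ i) → countTrue b ≡ suc (countTrue b′)
countTrue-remove {suc n} zero bt b′t agree rewrite bt | b′t =
  cong suc (countTrue-cong (λ i → agree (suc i) λ ()))
countTrue-remove {suc n} {b} {b′} (suc t) bt b′t agree
  rewrite agree zero (λ ())
  with b′ zero | countTrue-remove t bt b′t (λ i i≢t → agree (suc i) (i≢t ∘ suc-injective))
... | true  | r = cong suc r
... | false | r = r

isCycleMinᵇ-zero : ∀ {n} (s : Fin (suc n) → Fin (suc n)) → isCycleMinᵇ s zero ≡ true
isCycleMinᵇ-zero s = to T-≡ (from (T-isCycleMinᵇ s zero) λ _ _ → z≤n)

γ≡countTrue : ∀ {n} (s : Fin n → Fin n) → γ s ≡ countTrue (isCycleMinᵇ s)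
γ≡countTrue s = length-filter-tabulate (isCycleMinᵇ s) id

γ≤n : ∀ {n} (s : Fin n → Fin n) → γ s ≤ n
γ≤n s = subst (_≤ _) (sym (γ≡countTrue s)) (countTrue≤n _)

dec-cong : ∀ {n} {s s′ : Fin n → Fin n} → s ≗ s′ → dec s ≡ dec s′
dec-cong {n} {s} {s′} e = cong (n ∸_) (begin
  γ s                         ≡⟨ γ≡countTrue s ⟩
  countTrue (isCycleMinᵇ s)   ≡⟨ countTrue-cong (isCycleMinᵇ-cong e) ⟩
  countTrue (isCycleMinᵇ s′)  ≡⟨ γ≡countTrue s′ ⟨
  γ s′                        ∎)
  where open ≡-Reasoning

-- Adjoining the point 0 to a permutation

fixZero : ∀ {n} → (Fin n → Fin n) → Fin (suc n) → Fin (suc n)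
fixZero f = zero VF.∷ (suc ∘ f)

fixZero-injective⇔ : ∀ {n} (f : Fin n → Fin n) →
  Injective _≡_ _≡_ (fixZero f) ⇔ Injective _≡_ _≡_ f
fixZero-injective⇔ f = mk⇔ toInj fromInj
  where
  toInj : Injective _≡_ _≡_ (fixZero f) → Injective _≡_ _≡_ f
  toInj inj e = suc-injective (inj (cong suc e))
  fromInj : Injective _≡_ _≡_ f → Injective _≡_ _≡_ (fixZero f)
  fromInj inj {zero}  {zero}  e = refl
  fromInj inj {suc p} {suc q} e = cong suc (inj (suc-injective e))

isInjᵇ-fixZero : ∀ {n} (f : Fin n → Fin n) → isInjᵇ (fixZero f) ≡ isInjᵇ f
isInjᵇ-fixZero f = T-⇔⇒≡ (T-isInjᵇ (fixZero f)) (T-isInjᵇ f) (fixZero-injective⇔ f)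

iter-fixZero : ∀ {n} (f : Fin n → Fin n) k p → iter (fixZero f) k (suc p) ≡ suc (iter f k p)
iter-fixZero f zero    p = refl
iter-fixZero f (suc k) p = cong (fixZero f) (iter-fixZero f k p)

dec-fixZero : ∀ {n} (f : Fin n → Fin n) → Injective _≡_ _≡_ f → dec (fixZero f) ≡ dec f
dec-fixZero {n} f inj = cong (suc n ∸_) (begin
  γ (fixZero f)
    ≡⟨ γ≡countTrue (fixZero f) ⟩
  countTrue (isCycleMinᵇ (fixZero f))
    ≡⟨ countTrue-zero (isCycleMinᵇ (fixZero f)) (isCycleMinᵇ-zero (fixZero f)) ⟩
  suc (countTrue (isCycleMinᵇ (fixZero f) ∘ suc))
    ≡⟨ cong suc (countTrue-cong {b′ = isCycleMinᵇ f} cycleMin-suc) ⟩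
  suc (countTrue (isCycleMinᵇ f))
    ≡⟨ cong suc (γ≡countTrue f) ⟨
  suc (γ f)
    ∎)
  where
  open ≡-Reasoning
  shift : ∀ p → CycleMin (fixZero f) (suc p) ⇔ CycleMin f p
  shift p = mk⇔
    (λ h k → ℕₚ.≤-pred (subst (λ q → suc (toℕ p) ≤ toℕ q) (iter-fixZero f k p) (h k)))
    (λ h k → subst (λ q → suc (toℕ p) ≤ toℕ q) (sym (iter-fixZero f k p)) (s≤s (h k)))
  cycleMin-suc : ∀ p → isCycleMinᵇ (fixZero f) (suc p) ≡ isCycleMinᵇ f p
  cycleMin-suc p = T-⇔⇒≡ (T-isCycleMinᵇ⇔CycleMin (from (fixZero-injective⇔ f) inj) (suc p))
                         (T-isCycleMinᵇ⇔CycleMin inj p) (shift p)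

-- The paper's ψ, written as a transposition so that sum-permute can split sums along it.
ψ : ∀ {n} → Fin n → Fin n → Fin (suc n)
ψ t q = PC.transpose zero (suc t) (suc q)

ψ-cases : ∀ {n} (t q : Fin n) → (q ≡ t × ψ t q ≡ zero) ⊎ (q ≢ t × ψ t q ≡ suc q)
ψ-cases t q with q ≟ t
... | yes q≡t = inj₁ (q≡t , refl)
... | no  q≢t = inj₂ (q≢t , refl)

ψ-self : ∀ {n} (t : Fin n) → ψ t t ≡ zero
ψ-self t with ψ-cases t t
... | inj₁ (_ , ψt≡0)  = ψt≡0
... | inj₂ (t≢t , _)   = contradiction refl t≢t

ψ-injective : ∀ {n} (t : Fin n) → Injective _≡_ _≡_ (ψ t)
ψ-injective t {a} {b} e = suc-injective (begin
  suc a                              ≡⟨ PC.transpose-inverse (suc t) zero ⟨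
  PC.transpose (suc t) zero (ψ t a)  ≡⟨ cong (PC.transpose (suc t) zero) e ⟩
  PC.transpose (suc t) zero (ψ t b)  ≡⟨ PC.transpose-inverse (suc t) zero ⟩
  suc b                              ∎)
  where open ≡-Reasoning

ψ≢suc : ∀ {n} (t q : Fin n) → ψ t q ≢ suc t
ψ≢suc t q e with ψ-cases t q
... | inj₁ (_ , ψq≡0)   = contradiction (trans (sym ψq≡0) e) λ ()
... | inj₂ (q≢t , ψq≡s) = q≢t (suc-injective (trans (sym ψq≡s) e))

insertZeroBefore : ∀ {n} → Fin n → (Fin n → Fin n) → Fin (suc n) → Fin (suc n)
insertZeroBefore t f = suc t VF.∷ (ψ t ∘ f)

insertZeroBefore-injective⇔ : ∀ {n} t (f : Fin n → Fin n) →
  Injective _≡_ _≡_ (insertZeroBefore t f) ⇔ Injective _≡_ _≡_ f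
insertZeroBefore-injective⇔ t f = mk⇔ toInj fromInj
  where
  toInj : Injective _≡_ _≡_ (insertZeroBefore t f) → Injective _≡_ _≡_ f
  toInj inj e = suc-injective (inj (cong (ψ t) e))
  fromInj : Injective _≡_ _≡_ f → Injective _≡_ _≡_ (insertZeroBefore t f)
  fromInj inj {zero}  {zero}  e = refl
  fromInj inj {zero}  {suc q} e = contradiction (sym e) (ψ≢suc t (f q))
  fromInj inj {suc p} {zero}  e = contradiction e (ψ≢suc t (f p))
  fromInj inj {suc p} {suc q} e = cong suc (inj (ψ-injective t e))

isInjᵇ-insertZeroBefore : ∀ {n} t (f : Fin n → Fin n) → isInjᵇ (insertZeroBefore t f) ≡ isInjᵇ f
isInjᵇ-insertZeroBefore t f =
  T-⇔⇒≡ (T-isInjᵇ (insertZeroBefore t f)) (T-isInjᵇ f) (insertZeroBefore-injective⇔ t f)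

module _ {n : ℕ} (t : Fin n) {f : Fin n → Fin n} (f-inj : Injective _≡_ _≡_ f) where
  open ≡-Reasoning
  open Data.List.Extrema ℕₚ.≤-totalOrder using (argmin; argmin-all; f[argmin]≤f[xs])

  private
    s : Fin (suc n) → Fin (suc n)
    s = insertZeroBefore t f

    Reaches : Fin n → Set
    Reaches p = ∃ λ k → f (iter f k p) ≡ t

    lift-iter : ∀ p k → ∃ λ k′ → iter s k′ (suc p) ≡ suc (iter f k p)
    lift-iter p zero = zero , refl
    lift-iter p (suc k) with lift-iter p k | ψ-cases t (f (iter f k p))
    ... | k′ , e | inj₁ (x≡t , ψx≡0) = suc (suc k′) , (begin
          s (s (iter s k′ (suc p)))  ≡⟨ cong (s ∘ s) e ⟩
          s (ψ t (f (iter f k p)))   ≡⟨ cong s ψx≡0 ⟩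
          suc t                      ≡⟨ cong suc x≡t ⟨
          suc (f (iter f k p))       ∎)
    ... | k′ , e | inj₂ (_ , ψx≡s) = suc k′ , trans (cong s e) ψx≡s

    s-iter-cases : ∀ p k′ → (iter s k′ (suc p) ≡ zero × Reaches p)
                          ⊎ (∃ λ k → iter s k′ (suc p) ≡ suc (iter f k p))
    s-iter-cases p zero = inj₂ (zero , refl)
    s-iter-cases p (suc k′) with s-iter-cases p k′
    ... | inj₁ (e , k , x≡t) = inj₂ (suc k , trans (cong s e) (cong suc (sym x≡t)))
    ... | inj₂ (k , e) with ψ-cases t (f (iter f k p))
    ...   | inj₁ (x≡t , ψx≡0) = inj₁ (trans (cong s e) ψx≡0 , k , x≡t)
    ...   | inj₂ (_ , ψx≡s)   = inj₂ (suc k , trans (cong s e) ψx≡s)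

    cycleMin-suc⇔ : ∀ p → CycleMin s (suc p) ⇔ (CycleMin f p × ¬ Reaches p)
    cycleMin-suc⇔ p = mk⇔ (λ h → minimal h , unreached h) (λ (c , ¬r) k′ → bound k′ c ¬r)
      where
      p< : Fin (suc n) → Set
      p< q = toℕ p < toℕ q
      minimal : CycleMin s (suc p) → CycleMin f p
      minimal h k with lift-iter p k
      ... | k′ , e = ℕₚ.≤-pred (subst p< e (h k′))
      unreached : CycleMin s (suc p) → ¬ Reaches p
      unreached h (k , x≡t) with lift-iter p k
      ... | k′ , e = ℕₚ.≤⇒≯ z≤n (subst p< s[x]≡0 (h (suc k′)))
        where
        s[x]≡0 : iter s (suc k′) (suc p) ≡ zero
        s[x]≡0 = trans (cong s e) (trans (cong (ψ t) x≡t) (ψ-self t))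
      bound : ∀ k′ → CycleMin f p → ¬ Reaches p → p< (iter s k′ (suc p))
      bound k′ c ¬r with s-iter-cases p k′
      ... | inj₁ (_ , r) = contradiction r ¬r
      ... | inj₂ (k , e) = subst p< (sym e) (s≤s (c k))

    orbit : List (Fin n)
    orbit = applyUpTo (λ k → iter f k t) n

    m₀ : Fin n
    m₀ = argmin toℕ t orbit

    m₀-minimal : ∀ k → toℕ m₀ ≤ toℕ (iter f k t)
    m₀-minimal k with iter-below f-inj k t
    ... | k′ , k′<n , e = subst (λ q → toℕ m₀ ≤ toℕ q) (sym e)
                            (applyUpTo⁻ (λ k → iter f k t) n (f[argmin]≤f[xs] {f = toℕ} t orbit) k′<n)

    m₀-onOrbit : ∃ λ k → iter f k t ≡ m₀
    m₀-onOrbit =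
      argmin-all toℕ {P = λ x → ∃ λ k → iter f k t ≡ x} (zero , refl) (applyUpTo⁺₂ _ n λ k → k , refl)

    m₀-cycleMin : CycleMin f m₀
    m₀-cycleMin k with m₀-onOrbit
    ... | k₀ , e =
      subst (λ q → toℕ m₀ ≤ toℕ q) (trans (iter-+ f k k₀ t) (cong (iter f k) e)) (m₀-minimal (k ℕ.+ k₀))

    m₀-reaches : Reaches m₀
    m₀-reaches with m₀-onOrbit
    ... | k₀ , e₀ with iter-return f-inj k₀ e₀
    ...   | b , e = iter-positive f-inj b e

    reaching-cycleMin≡m₀ : ∀ p → CycleMin f p → Reaches p → p ≡ m₀
    reaching-cycleMin≡m₀ p c (k , e) with iter-return f-inj (suc k) e | m₀-onOrbit
    ... | b , e′ | k₀ , e₀ = toℕ-injective (ℕₚ.≤-antisym p≤m₀ m₀≤p)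
      where
      m₀≤p : toℕ m₀ ≤ toℕ p
      m₀≤p = subst (λ q → toℕ m₀ ≤ toℕ q) e′ (m₀-minimal b)
      p≤m₀ : toℕ p ≤ toℕ m₀
      p≤m₀ = subst (λ q → toℕ p ≤ toℕ q) (trans (iter-+ f k₀ (suc k) p) (trans (cong (iter f k₀) e) e₀))
                   (c (k₀ ℕ.+ suc k))

    s-inj : Injective _≡_ _≡_ s
    s-inj = from (insertZeroBefore-injective⇔ t f) f-inj

    isCycleMinᵇ-suc : ∀ p → p ≢ m₀ → isCycleMinᵇ f p ≡ isCycleMinᵇ s (suc p)
    isCycleMinᵇ-suc p p≢m₀ =
      T-⇔⇒≡ (T-isCycleMinᵇ⇔CycleMin f-inj p) (T-isCycleMinᵇ⇔CycleMin s-inj (suc p))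
            (⇔-sym (cycleMin-suc⇔ p) ⇔-∘ mk⇔ (λ c → c , p≢m₀ ∘ reaching-cycleMin≡m₀ p c) proj₁)

  dec-insertZeroBefore : dec (insertZeroBefore t f) ≡ suc (dec f)
  dec-insertZeroBefore = trans (cong (suc n ∸_) γ-equal) (ℕₚ.+-∸-assoc 1 (γ≤n f))
    where
    γ-equal : γ s ≡ γ f
    γ-equal = begin
      γ s                                    ≡⟨ γ≡countTrue s ⟩
      countTrue (isCycleMinᵇ s)              ≡⟨ countTrue-zero (isCycleMinᵇ s) (isCycleMinᵇ-zero s) ⟩
      suc (countTrue (isCycleMinᵇ s ∘ suc))  ≡⟨ countTrue-remove m₀ m₀-isMin sm₀-notMin isCycleMinᵇ-suc ⟨
      countTrue (isCycleMinᵇ f)              ≡⟨ γ≡countTrue f ⟨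
      γ f                                    ∎
      where
      m₀-isMin : isCycleMinᵇ f m₀ ≡ true
      m₀-isMin = to T-≡ (from (T-isCycleMinᵇ⇔CycleMin f-inj m₀) m₀-cycleMin)
      sm₀-notMin : isCycleMinᵇ s (suc m₀) ≡ false
      sm₀-notMin = ¬-not λ e →
        proj₂ (to (cycleMin-suc⇔ m₀) (to (T-isCycleMinᵇ⇔CycleMin s-inj (suc m₀)) (from T-≡ e))) m₀-reaches

-- Residues modulo m

∸-congruent : ∀ {a b m} .{{_ : NonZero m}} → a ≤ b → m ∣ b ∸ a → b % m ≡ a % m
∸-congruent {m = m} a≤b m∣ = trans (cong (_% m) (sym (ℕₚ.m+[n∸m]≡n a≤b))) (%-remove-+ʳ _ m∣)

∣-∣-congruent : ∀ {d k m} .{{_ : NonZero m}} → m ∣ ∣ d - k ∣ → d % m ≡ k % m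
∣-∣-congruent {d} {k} {m} m∣ with ℕₚ.≤-total k d
... | inj₁ k≤d = ∸-congruent k≤d (subst (m ∣_) (ℕₚ.m≤n⇒∣n-m∣≡n∸m k≤d) m∣)
... | inj₂ d≤k = sym (∸-congruent d≤k (subst (m ∣_) (ℕₚ.m≤n⇒∣m-n∣≡n∸m d≤k) m∣))

congrᵇ⇒≡% : ∀ {d k m} .{{_ : NonZero m}} → k < m → congrᵇ d k m ≡ true → k ≡ d % m
congrᵇ⇒≡% {d} {k} {m} k<m h with m ∣? ∣ d - k ∣
... | yes m∣ = sym (trans (∣-∣-congruent m∣) (m<n⇒m%n≡m k<m))

congrᵇ-% : ∀ d m .{{_ : NonZero m}} → congrᵇ d (d % m) m ≡ true
congrᵇ-% d m with m ∣? ∣ d - d % m ∣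
... | yes _  = refl
... | no ¬m∣ = contradiction (divides (d / m) (begin
  ∣ d - d % m ∣                  ≡⟨ ℕₚ.m≤n⇒∣n-m∣≡n∸m (m%n≤m d m) ⟩
  d ∸ d % m                      ≡⟨ cong (_∸ d % m) (m≡m%n+[m/n]*n d m) ⟩
  d % m ℕ.+ d / m ℕ.* m ∸ d % m  ≡⟨ ℕₚ.m+n∸m≡n (d % m) _ ⟩
  d / m ℕ.* m                    ∎)) ¬m∣
  where open ≡-Reasoning

-- Sums in a commutative ring

module _ {c ℓ} (R : CommutativeRing c ℓ) where
  open CommutativeRing R hiding (zero) renaming (refl to ≈-refl; sym to ≈-sym; trans to ≈-trans)
  open Per R
  open import Algebra.Properties.Semiring.Sum semiring
    using (sum; sum-cong-≋; sum-replicate-zero; sum-remove; sum-permute; ∑-distrib-+; *-distribˡ-sum)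
  open import Algebra.Properties.CommutativeSemigroup *-commutativeSemigroup using (x∙yz≈y∙xz)
  open import Relation.Binary.Reasoning.Setoid setoid

  sumL-cong : ∀ {A : Set} {f g : A → Carrier} xs → (∀ x → f x ≈ g x) → sumL f xs ≈ sumL g xs
  sumL-cong []       e = ≈-refl
  sumL-cong (x ∷ xs) e = +-cong (e x) (sumL-cong xs e)

  *-distribˡ-sumL : ∀ {A : Set} a (f : A → Carrier) xs → a * sumL f xs ≈ sumL (λ x → a * f x) xs
  *-distribˡ-sumL a f []       = zeroʳ a
  *-distribˡ-sumL a f (x ∷ xs) = ≈-trans (distribˡ a _ _) (+-congˡ (*-distribˡ-sumL a f xs))

  sumL-++ : ∀ {A : Set} (f : A → Carrier) xs ys → sumL f (xs ++ ys) ≈ sumL f xs + sumL f ys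
  sumL-++ f []       ys = ≈-sym (+-identityˡ _)
  sumL-++ f (x ∷ xs) ys = ≈-trans (+-congˡ (sumL-++ f xs ys)) (≈-sym (+-assoc _ _ _))

  sumL-concatMap : ∀ {A B : Set} (f : B → Carrier) (g : A → List B) xs →
    sumL f (concatMap g xs) ≈ sumL (λ x → sumL f (g x)) xs
  sumL-concatMap f g []       = ≈-refl
  sumL-concatMap f g (x ∷ xs) =
    ≈-trans (sumL-++ f (g x) (concatMap g xs)) (+-congˡ (sumL-concatMap f g xs))

  sumL-map : ∀ {A B : Set} (f : B → Carrier) (g : A → B) xs → sumL f (map g xs) ≡ sumL (f ∘ g) xs
  sumL-map f g []       = refl
  sumL-map f g (x ∷ xs) = cong (f (g x) +_) (sumL-map f g xs)

  sumL-filter : ∀ {A : Set} (f : A → Carrier) (b : A → Bool) xs →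
    sumL f (filter (T? ∘ b) xs) ≈ sumL (λ x → if b x then f x else 0#) xs
  sumL-filter f b [] = ≈-refl
  sumL-filter f b (x ∷ xs) with b x
  ... | true  = +-congˡ (sumL-filter f b xs)
  ... | false = ≈-trans (sumL-filter f b xs) (≈-sym (+-identityˡ _))

  sumL-tabulate : ∀ {A : Set} {n} (f : A → Carrier) (g : Fin n → A) →
    sumL f (tabulate g) ≡ sum (f ∘ g)
  sumL-tabulate {n = zero}  f g = refl
  sumL-tabulate {n = suc n} f g = cong (f (g zero) +_) (sumL-tabulate f (g ∘ suc))

  sumL-applyUpTo : ∀ {A : Set} n (f : A → Carrier) (g : ℕ → A) →
    sumL f (applyUpTo g n) ≡ sum {n} (f ∘ g ∘ toℕ)
  sumL-applyUpTo zero    f g = refl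
  sumL-applyUpTo (suc n) f g = cong (f (g zero) +_) (sumL-applyUpTo n f (g ∘ suc))

  sumL-sum-comm : ∀ {A : Set} {n} (u : A → Fin n → Carrier) xs →
    sumL (λ x → sum (u x)) xs ≈ sum (λ i → sumL (λ x → u x i) xs)
  sumL-sum-comm {n = n} u [] = ≈-sym (sum-replicate-zero n)
  sumL-sum-comm u (x ∷ xs) = ≈-trans (+-congˡ (sumL-sum-comm u xs)) (≈-sym (∑-distrib-+ (u x) _))

  prodL-tabulate : ∀ {A : Set} {n} (f : A → Carrier) (g : Fin n → A) →
    prodL f (tabulate g) ≡ prodL (f ∘ g) (allFin n)
  prodL-tabulate {n = zero}  f g = refl
  prodL-tabulate {n = suc n} f g =
    cong (f (g zero) *_) (trans (prodL-tabulate f (g ∘ suc)) (sym (prodL-tabulate (f ∘ g) suc)))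

  prodL-cong : ∀ {A : Set} {f g : A → Carrier} xs → (∀ x → f x ≈ g x) → prodL f xs ≈ prodL g xs
  prodL-cong []       e = ≈-refl
  prodL-cong (x ∷ xs) e = *-cong (e x) (prodL-cong xs e)

  sumL-maps-suc : ∀ {k N} (h : (Fin (suc k) → Fin N) → Carrier) →
    sumL h (maps (suc k) N) ≈ sumL (λ f → sum (λ i → h (i VF.∷ f))) (maps k N)
  sumL-maps-suc {k} {N} h = ≈-trans (sumL-concatMap h _ (maps k N)) (sumL-cong (maps k N) λ f →
    reflexive (trans (sumL-map h (VF._∷ f) (allFin N)) (sumL-tabulate (h ∘ (VF._∷ f)) id)))

  -- The hypothesis on e expresses that e is a bijection onto the complement of a.
  sumL-maps-avoiding : ∀ {N} k (a : Fin (suc N)) (e : Fin N → Fin (suc N)) →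
    (∀ u → sum u ≈ u a + sum (u ∘ e)) →
    (h : (Fin k → Fin (suc N)) → Carrier) → (∀ {f g} → f ≗ g → h f ≈ h g) →
    (∀ f p → f p ≡ a → h f ≈ 0#) →
    sumL h (maps k (suc N)) ≈ sumL (λ f → h (e ∘ f)) (maps k N)
  sumL-maps-avoiding zero    a e split h h-cong h-hit = +-congʳ (h-cong λ ())
  sumL-maps-avoiding {N} (suc k) a e split h h-cong h-hit = begin
    sumL h (maps (suc k) (suc N))
      ≈⟨ sumL-maps-suc h ⟩
    sumL (λ f → sum (λ i → h (i VF.∷ f))) (maps k (suc N))
      ≈⟨ sumL-cong (maps k (suc N)) drop-a ⟩
    sumL (λ f → sum (λ j → h′ j f)) (maps k (suc N))
      ≈⟨ sumL-sum-comm (λ f j → h′ j f) (maps k (suc N)) ⟩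
    sum (λ j → sumL (h′ j) (maps k (suc N)))
      ≈⟨ sum-cong-≋ recurse ⟩
    sum (λ j → sumL (λ f → h′ j (e ∘ f)) (maps k N))
      ≈⟨ sumL-sum-comm (λ f j → h′ j (e ∘ f)) (maps k N) ⟨
    sumL (λ f → sum (λ j → h′ j (e ∘ f))) (maps k N)
      ≈⟨ sumL-cong (maps k N) (λ f → sum-cong-≋ (e-∷ f)) ⟩
    sumL (λ f → sum (λ j → h (e ∘ (j VF.∷ f)))) (maps k N)
      ≈⟨ sumL-maps-suc (λ f → h (e ∘ f)) ⟨
    sumL (λ f → h (e ∘ f)) (maps (suc k) N)
      ∎
    where
    h′ : Fin N → (Fin k → Fin (suc N)) → Carrier
    h′ j f = h (e j VF.∷ f)
    drop-a : ∀ f → sum (λ i → h (i VF.∷ f)) ≈ sum (λ j → h′ j f)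
    drop-a f = ≈-trans (split _) (≈-trans (+-congʳ (h-hit (a VF.∷ f) zero refl)) (+-identityˡ _))
    recurse : ∀ j → sumL (h′ j) (maps k (suc N)) ≈ sumL (λ f → h′ j (e ∘ f)) (maps k N)
    recurse j = sumL-maps-avoiding k a e split (h′ j)
      (λ {f} {g} f≗g → h-cong {e j VF.∷ f} {e j VF.∷ g} (∷-cong refl f≗g))
      (λ f p → h-hit (e j VF.∷ f) (suc p))
    e-∷ : ∀ f j → h′ j (e ∘ f) ≈ h (e ∘ (j VF.∷ f))
    e-∷ f j = h-cong {e j VF.∷ (e ∘ f)} {e ∘ (j VF.∷ f)} (∷-cong refl λ _ → refl)

  sum-ψ : ∀ {n} (t : Fin n) (u : Fin (suc n) → Carrier) → sum u ≈ u (suc t) + sum (u ∘ ψ t)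
  sum-ψ t u = sum-permute u (Perm.transpose zero (suc t))

  pow-+ : ∀ x a b → pow x (a ℕ.+ b) ≈ pow x a * pow x b
  pow-+ x zero    b = ≈-sym (*-identityˡ _)
  pow-+ x (suc a) b = ≈-trans (*-congˡ (pow-+ x a b)) (≈-sym (*-assoc _ _ _))

  pow-multiple : ∀ {x m} → pow x m ≈ 1# → ∀ q → pow x (q ℕ.* m) ≈ 1#
  pow-multiple xᵐ≈1 zero    = ≈-refl
  pow-multiple {x} {m} xᵐ≈1 (suc q) =
    ≈-trans (pow-+ x m (q ℕ.* m)) (≈-trans (*-cong xᵐ≈1 (pow-multiple xᵐ≈1 q)) (*-identityˡ 1#))

  pow-% : ∀ {x} m .{{_ : NonZero m}} → pow x m ≈ 1# → ∀ d → pow x d ≈ pow x (d % m)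
  pow-% {x} m xᵐ≈1 d = begin
    pow x d                                ≡⟨ cong (pow x) (m≡m%n+[m/n]*n d m) ⟩
    pow x (d % m ℕ.+ (d / m) ℕ.* m)        ≈⟨ pow-+ x (d % m) _ ⟩
    pow x (d % m) * pow x ((d / m) ℕ.* m)  ≈⟨ *-congˡ (pow-multiple xᵐ≈1 (d / m)) ⟩
    pow x (d % m) * 1#                     ≈⟨ *-identityʳ _ ⟩
    pow x (d % m)                          ∎

  sum-residue : ∀ {ω} m .{{_ : NonZero m}} → pow ω m ≈ 1# → ∀ d x →
    sum {m} (λ k → pow ω (toℕ k) * (if congrᵇ d (toℕ k) m then x else 0#)) ≈ pow ω d * x
  sum-residue {ω} m@(suc m-1) ωᵐ≈1 d x = begin
    sum u                      ≈⟨ sum-remove {i = r} u ⟩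
    u r + sum (u ∘ punchIn r)  ≈⟨ +-cong u[r] (≈-trans (sum-cong-≋ u[others]) (sum-replicate-zero m-1)) ⟩
    pow ω d * x + 0#           ≈⟨ +-identityʳ _ ⟩
    pow ω d * x                ∎
    where
    summand : ℕ → Carrier
    summand k = pow ω k * (if congrᵇ d k m then x else 0#)
    u : Fin m → Carrier
    u = summand ∘ toℕ
    r : Fin m
    r = fromℕ< (m%n<n d m)
    u[r] : u r ≈ pow ω d * x
    u[r] = begin
      summand (toℕ r)    ≡⟨ cong summand (toℕ-fromℕ< (m%n<n d m)) ⟩
      summand (d % m)    ≡⟨ cong (λ b → pow ω (d % m) * (if b then x else 0#)) (congrᵇ-% d m) ⟩
      pow ω (d % m) * x  ≈⟨ *-congʳ (pow-% m ωᵐ≈1 d) ⟨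
      pow ω d * x        ∎
    u[others] : ∀ i → u (punchIn r i) ≈ 0#
    u[others] i with congrᵇ d (toℕ (punchIn r i)) m in eq
    ... | false = zeroʳ _
    ... | true  = contradiction
      (toℕ-injective (trans (congrᵇ⇒≡% {d} (toℕ<n (punchIn r i)) eq) (sym (toℕ-fromℕ< (m%n<n d m)))))
      (punchInᵢ≢i r i)

  -- Expansion along row 0

  minor1≡ψ : ∀ {n} (A : Fin (suc n) → Fin (suc n) → Carrier) t p q →
    minor1 A t p q ≡ A (suc p) (ψ t q)
  minor1≡ψ A t p q with q ≟ t
  ... | yes _ = refl
  ... | no  _ = refl

  diagonal : ∀ {n} → (Fin n → Fin n → Carrier) → (Fin n → Fin n) → Carrier
  diagonal {n} B s = prodL (λ p → B p (s p)) (allFin n)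

  diagonal-cong : ∀ {n} (B : Fin n → Fin n → Carrier) {s s′} → s ≗ s′ →
    diagonal B s ≈ diagonal B s′
  diagonal-cong B e = prodL-cong (allFin _) (λ p → reflexive (cong (B p) (e p)))

  diagonal-fixZero : ∀ {n} (A : Fin (suc n) → Fin (suc n) → Carrier) f →
    diagonal A (fixZero f) ≡ A zero zero * diagonal (minor11 A) f
  diagonal-fixZero A f = cong (A zero zero *_) (prodL-tabulate (λ p → A p (fixZero f p)) suc)

  diagonal-insertZeroBefore : ∀ {n} (A : Fin (suc n) → Fin (suc n) → Carrier) t f →
    diagonal A (insertZeroBefore t f) ≈ A zero (suc t) * diagonal (minor1 A t) f
  diagonal-insertZeroBefore A t f = *-congˡ (≈-trans
    (reflexive (prodL-tabulate (λ p → A p (insertZeroBefore t f p)) suc))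
    (prodL-cong (allFin _) (λ p → reflexive (sym (minor1≡ψ A t p (f p))))))

  module _ (ω : Carrier) where

    term : ∀ {n} → (Fin n → Fin n → Carrier) → (Fin n → Fin n) → Carrier
    term B s = if isInjᵇ s then pow ω (dec s) * diagonal B s else 0#

    per′ : ∀ n → (Fin n → Fin n → Carrier) → Carrier
    per′ n B = sumL (term B) (maps n n)

    term-cong : ∀ {n} (B : Fin n → Fin n → Carrier) {s s′} → s ≗ s′ → term B s ≈ term B s′
    term-cong B {s} {s′} e rewrite isInjᵇ-cong e | dec-cong e with isInjᵇ s′
    ... | true  = *-congˡ (diagonal-cong B e)
    ... | false = ≈-refl

    term-repeat : ∀ {n} (B : Fin (suc n) → Fin (suc n) → Carrier) a f p → f p ≡ a →
      term B (a VF.∷ f) ≈ 0#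
    term-repeat B a f p fp≡a with isInjᵇ (a VF.∷ f) in eq
    ... | false = ≈-refl
    ... | true  = contradiction (to (T-isInjᵇ (a VF.∷ f)) (from T-≡ eq) {zero} {suc p} (sym fp≡a)) λ ()

    term-fixZero : ∀ {n} (A : Fin (suc n) → Fin (suc n) → Carrier) f →
      term A (fixZero f) ≈ A zero zero * term (minor11 A) f
    term-fixZero A f rewrite isInjᵇ-fixZero f with isInjᵇ f in eq
    ... | false = ≈-sym (zeroʳ _)
    ... | true  = begin
      pow ω (dec (fixZero f)) * diagonal A (fixZero f)
        ≡⟨ cong₂ _*_ (cong (pow ω) (dec-fixZero f f-inj)) (diagonal-fixZero A f) ⟩
      pow ω (dec f) * (A zero zero * diagonal (minor11 A) f)  ≈⟨ x∙yz≈y∙xz _ _ _ ⟩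
      A zero zero * (pow ω (dec f) * diagonal (minor11 A) f)  ∎
      where
      f-inj : Injective _≡_ _≡_ f
      f-inj = to (T-isInjᵇ f) (from T-≡ eq)

    term-insertZeroBefore : ∀ {n} (A : Fin (suc n) → Fin (suc n) → Carrier) t f →
      term A (insertZeroBefore t f) ≈ ω * (A zero (suc t) * term (minor1 A t) f)
    term-insertZeroBefore A t f rewrite isInjᵇ-insertZeroBefore t f with isInjᵇ f in eq
    ... | false = ≈-sym (≈-trans (*-congˡ (zeroʳ _)) (zeroʳ ω))
    ... | true  = begin
      pow ω (dec (insertZeroBefore t f)) * diagonal A (insertZeroBefore t f)
        ≈⟨ *-cong (reflexive (cong (pow ω) (dec-insertZeroBefore t f-inj))) (diagonal-insertZeroBefore A t f) ⟩
      (ω * pow ω (dec f)) * (A zero (suc t) * diagonal (minor1 A t) f)  ≈⟨ *-assoc _ _ _ ⟩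
      ω * (pow ω (dec f) * (A zero (suc t) * diagonal (minor1 A t) f))  ≈⟨ *-congˡ (x∙yz≈y∙xz _ _ _) ⟩
      ω * (A zero (suc t) * (pow ω (dec f) * diagonal (minor1 A t) f))  ∎
      where
      f-inj : Injective _≡_ _≡_ f
      f-inj = to (T-isInjᵇ f) (from T-≡ eq)

    per≈per′ : ∀ m .{{_ : NonZero m}} → pow ω m ≈ 1# → ∀ n (B : Fin n → Fin n → Carrier) →
      per m ω n B ≈ per′ n B
    per≈per′ m ωᵐ≈1 n B = begin
      per m ω n B
        ≡⟨ sumL-applyUpTo m (λ k → pow ω k * sumL (diagonal B) (permsKM n k m)) id ⟩
      sum {m} (λ k → pow ω (toℕ k) * sumL (diagonal B) (permsKM n (toℕ k) m))
        ≈⟨ sum-cong-≋ {m} (λ k → ≈-trans (*-congˡ (unfilter (toℕ k))) (*-distribˡ-sumL _ _ (maps n n))) ⟩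
      sum {m} (λ k → sumL (weighted k) (maps n n))
        ≈⟨ sumL-sum-comm {n = m} (λ s k → weighted k s) (maps n n) ⟨
      sumL (λ s → sum {m} (λ k → weighted k s)) (maps n n)
        ≈⟨ sumL-cong (maps n n) residue ⟩
      per′ n B
        ∎
      where
      selected : ℕ → (Fin n → Fin n) → Carrier
      selected k s = if isInjᵇ s then (if congrᵇ (dec s) k m then diagonal B s else 0#) else 0#
      weighted : Fin m → (Fin n → Fin n) → Carrier
      weighted k s = pow ω (toℕ k) * selected (toℕ k) s
      unfilter : ∀ k → sumL (diagonal B) (permsKM n k m) ≈ sumL (selected k) (maps n n)
      unfilter k = ≈-trans (sumL-filter (diagonal B) (λ s → congrᵇ (dec s) k m) (perms n))
                           (sumL-filter _ isInjᵇ (maps n n))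
      residue : ∀ s → sum {m} (λ k → weighted k s) ≈ term B s
      residue s with isInjᵇ s
      ... | true  = sum-residue m ωᵐ≈1 (dec s) (diagonal B s)
      ... | false = ≈-trans (sum-cong-≋ {m} λ _ → zeroʳ _) (sum-replicate-zero m)

    per′-expand : ∀ N (A : Fin (suc N) → Fin (suc N) → Carrier) →
      per′ (suc N) A ≈
        A zero zero * per′ N (minor11 A) + ω * sumL (λ t → A zero (suc t) * per′ N (minor1 A t)) (allFin N)
    per′-expand N A = begin
      per′ (suc N) A
        ≈⟨ sumL-maps-suc (term A) ⟩
      sumL (λ f → sum (λ i → headed i f)) (maps N (suc N))
        ≈⟨ sumL-sum-comm (λ f i → headed i f) (maps N (suc N)) ⟩
      sum (λ i → sumL (headed i) (maps N (suc N)))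
        ≈⟨ +-cong headed-zero headed-suc ⟩
      A zero zero * per′ N (minor11 A) + ω * sumL row (allFin N)
        ∎
      where
      headed : Fin (suc N) → (Fin N → Fin (suc N)) → Carrier
      headed i f = term A (i VF.∷ f)
      headed-cong : ∀ i {f g} → f ≗ g → headed i f ≈ headed i g
      headed-cong i f≗g = term-cong A (∷-cong refl f≗g)
      row : Fin N → Carrier
      row t = A zero (suc t) * per′ N (minor1 A t)
      headed-zero : sumL (headed zero) (maps N (suc N)) ≈ A zero zero * per′ N (minor11 A)
      headed-zero = begin
        sumL (headed zero) (maps N (suc N))
          ≈⟨ sumL-maps-avoiding N zero suc (λ _ → ≈-refl) (headed zero) (headed-cong zero) (term-repeat A zero) ⟩
        sumL (λ g → term A (fixZero g)) (maps N N)
          ≈⟨ sumL-cong (maps N N) (term-fixZero A) ⟩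
        sumL (λ g → A zero zero * term (minor11 A) g) (maps N N)
          ≈⟨ *-distribˡ-sumL _ _ (maps N N) ⟨
        A zero zero * per′ N (minor11 A)
          ∎
      headed-suc′ : ∀ t → sumL (headed (suc t)) (maps N (suc N)) ≈ ω * row t
      headed-suc′ t = begin
        sumL (headed (suc t)) (maps N (suc N))
          ≈⟨ sumL-maps-avoiding N (suc t) (ψ t) (sum-ψ t) (headed (suc t)) (headed-cong (suc t))
                                (term-repeat A (suc t)) ⟩
        sumL (λ g → term A (insertZeroBefore t g)) (maps N N)
          ≈⟨ sumL-cong (maps N N) (term-insertZeroBefore A t) ⟩
        sumL (λ g → ω * (A zero (suc t) * term (minor1 A t) g)) (maps N N)
          ≈⟨ *-distribˡ-sumL ω _ (maps N N) ⟨
        ω * sumL (λ g → A zero (suc t) * term (minor1 A t) g) (maps N N)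
          ≈⟨ *-congˡ (*-distribˡ-sumL _ _ (maps N N)) ⟨
        ω * row t
          ∎
      headed-suc : sum (λ t → sumL (headed (suc t)) (maps N (suc N))) ≈ ω * sumL row (allFin N)
      headed-suc = begin
        sum (λ t → sumL (headed (suc t)) (maps N (suc N)))  ≈⟨ sum-cong-≋ headed-suc′ ⟩
        sum (λ t → ω * row t)                               ≈⟨ *-distribˡ-sum ω row ⟨
        ω * sum row                                         ≡⟨ cong (ω *_) (sumL-tabulate row id) ⟨
        ω * sumL row (allFin N)                             ∎

mainTheorem3 : ∀ {c ℓ} (R : CommutativeRing c ℓ) (m N : ℕ) → 3 ≤ m → 2 ≤ N →
    let open CommutativeRing R
        open Per R
    in (ω : Carrier) → pow ω m ≈ 1# → (∀ k → 0 < k → k < m → ¬ (pow ω k ≈ 1#)) →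
    (A : Fin (suc N) → Fin (suc N) → Carrier) →
    per m ω (suc N) A ≈
      A F.zero F.zero * per m ω N (minor11 A)
      + ω * sumL (λ t → A F.zero (F.suc t) * per m ω N (minor1 A t)) (allFin N)
mainTheorem3 R m@(suc _) N _ _ ω ωᵐ≈1 _ A = begin
  per m ω (suc N) A       ≈⟨ per≈per′ R ω m ωᵐ≈1 (suc N) A ⟩
  per′ R ω (suc N) A      ≈⟨ per′-expand R ω N A ⟩
  expansion (per′ R ω N)  ≈⟨ +-cong (*-congˡ (per′≈per (minor11 A)))
                                      (*-congˡ (sumL-cong R (allFin N) λ t → *-congˡ (per′≈per (minor1 A t)))) ⟩
  expansion (per m ω N)    ∎
  where
  open CommutativeRing R hiding (zero) renaming (sym to ≈-sym)
  open Per R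
  open import Relation.Binary.Reasoning.Setoid setoid
  expansion : ((Fin N → Fin N → Carrier) → Carrier) → Carrier
  expansion P = A zero zero * P (minor11 A) + ω * sumL (λ t → A zero (suc t) * P (minor1 A t)) (allFin N)
  per′≈per : ∀ B → per′ R ω N B ≈ per m ω N B
  per′≈per B = ≈-sym (per≈per′ R ω m ωᵐ≈1 N B)
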